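{- $\mathcal H$ $implements_1$ $\mathcal A_1$: for every $B\subseteq C_0$, in the unique executions of $\mathcal A_1$ and $\mathcal H$ with $B$ presented at time $0$, for every concept $c\in C$, if $rep(c)$ fires at time $level(c)$ in $\mathcal A_1$, then in $\mathcal H$ at least $m(1-\epsilon)$ of the neurons in $reps(c)$ fire at time $level(c)$.
   Context: Concept hierarchies: fix positive integers $\ell_{max},n,k$. A universal set $D$ of concepts is partitioned into disjoint sets $D_0,\dots,D_{\ell_{max}}$ with $|D_0|=n$; for $c\in D_\ell$ write $level(c)=\ell$. A concept hierarchy $\mathcal C$ consists of $C\subseteq D$, with $C_\ell=C\cap D_\ell$, and for each $c\in C_\ell$, $1\le\ell\le\ell_{max}$, a set $children(c)\subseteq C_{\ell-1}$, such that $|C_{\ell_{max}}|=k$, $|children(c)|=k$ for all $c\in C_\ell$ with $\ell\ge1$, and $children(c)\cap children(c')=\emptyset$ for distinct $c,c'\in C_\ell$, $\ell\ge1$. Network dynamics (common): neurons are partitioned into layers $N_0,\dots,N_{\ell_{max}}$; fixed edge weights $w(u,v)\in\{0,1\}$ for $u\in N_{\ell-1}$, $v\in N_\ell$; threshold $\tau$; a fixed set $F$ of failed neurons which never fire. Time is discrete. Layer-$0$ firing is determined by the input and occurs only at time $0$. Non-input neurons do not fire at time $0$; a non-failed $v\in N_\ell$, $\ell\ge1$, fires at time $t\ge1$ iff $\sum_{u\in N_{\ell-1}}w(u,v)x_u(t-1)\ge\tau$, where $x_u(t-1)\in\{0,1\}$ indicates whether $u$ fires at time $t-1$. Parameters: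 reals $r_1,r_2,\epsilon\in[0,1]$ with $r_1\le r_2(1-\epsilon)$, and a positive integer $m$. $\mathcal A_1$: no failures ($F=\emptyset$); each $c\in C$ has a neuron $rep(c)\in N_{level(c)}$, all distinct; $w(u,v)=1$ iff $v=rep(c)$, $u=rep(c')$ for some $c\in C$, $c'\in children(c)$; $\tau=r_2k$. Presenting $B\subseteq C_0$: the layer-$0$ neurons firing at time $0$ are exactly $\{rep(b):b\in B\}$. $\mathcal H$: each $c\in C$ has a set $reps(c)\subseteq N_{level(c)}$ of exactly $m$ neurons, these sets pairwise disjoint; $w(u,v)=1$ iff $v\in reps(c)$, $u\in reps(c')$ for some $c\in C$, $c'\in children(c)$, and $0$ otherwise; $\tau=r_2km(1-\epsilon)$; the failed set $F$ satisfies $|reps(c)\setminus F|\ge m(1-\epsilon)$ for every $c\in C$. Presenting $B\subseteq C_0$: the layer-$0$ neurons firing at time $0$ are exactly $\bigcup_{b\in B}reps(b)\setminus F$. -}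

module Defs where

open import Level using (Level; _⊔_; 0ℓ) renaming (suc to lsuc)
open import Data.Nat using (ℕ; zero; suc)
open import Data.Fin using (Fin; toℕ; inject₁; fromℕ)
open import Data.Fin.Subset using (Subset; _∈_; _∉_; _⊆_; ∣_∣; _∩_; ∁)
open import Data.Vec using (tabulate)
open import Data.Bool using (Bool; true; false; _∧_)
open import Data.Product using (Σ; _×_; ∃; ∃-syntax)
open import Relation.Binary.PropositionalEquality using (_≡_; _≢_)
open import Relation.Binary.Structures using (IsTotalOrder)
open import Algebra.Bundles using (CommutativeRing)
open import Function.Bundles using (_⇔_)

-- Stand-in for the real numbers: an arbitrary (totally) ordered
-- commutative ring.  ℝ is an instance, so a statement proved for every
-- such ring holds in particular for ℝ.

record OrderedCommRing (c ℓ₁ ℓ₂ : Level) : Set (lsuc (c ⊔ ℓ₁ ⊔ ℓ₂)) where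
  field
    commutativeRing : CommutativeRing c ℓ₁
  open CommutativeRing commutativeRing public
  field
    _≤_          : Carrier → Carrier → Set ℓ₂
    isTotalOrder : IsTotalOrder _≈_ _≤_
    +-monoˡ-≤    : ∀ {x y} z → x ≤ y → (x + z) ≤ (y + z)
    *-nonneg     : ∀ {x y} → 0# ≤ x → 0# ≤ y → 0# ≤ (x * y)

  embed : ℕ → Carrier
  embed zero    = 0#
  embed (suc n) = 1# + embed n

-- Concept hierarchies.  Levels are Fin (suc ℓmax) = {0,…,ℓmax};
-- D_ℓ = Fin (dsz ℓ), with |D_0| = n.  For i : Fin ℓmax, level (suc i)
-- is the level above level (inject₁ i).

record ConceptHierarchy (ℓmax n k : ℕ) : Set where
  field
    dsz      : Fin (suc ℓmax) → ℕ
    dsz-0    : dsz Data.Fin.zero ≡ n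
    C        : (ℓ : Fin (suc ℓmax)) → Subset (dsz ℓ)
    children : (i : Fin ℓmax) → Fin (dsz (Data.Fin.suc i)) → Subset (dsz (inject₁ i))
    top-size      : ∣ C (fromℕ ℓmax) ∣ ≡ k
    children-⊆    : ∀ i c → c ∈ C (Data.Fin.suc i) → children i c ⊆ C (inject₁ i)
    children-size : ∀ i c → c ∈ C (Data.Fin.suc i) → ∣ children i c ∣ ≡ k
    children-disj : ∀ i c c' → c ∈ C (Data.Fin.suc i) → c' ∈ C (Data.Fin.suc i) → c ≢ c' →
                    ∀ x → x ∈ children i c → x ∉ children i c'

record Network (ℓmax : ℕ) : Set where
  field
    size : Fin (suc ℓmax) → ℕ
    w    : (i : Fin ℓmax) → Fin (size (inject₁ i)) → Fin (size (Data.Fin.suc i)) → Bool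

open Network public

-- firing pattern: x ℓ v t = true iff neuron v of layer ℓ fires at time t
Firing : ∀ {ℓmax} → Network ℓmax → Set
Firing {ℓmax} 𝒩 = (ℓ : Fin (suc ℓmax)) → Fin (size 𝒩 ℓ) → ℕ → Bool

module _ {c ℓ₁ ℓ₂} (R : OrderedCommRing c ℓ₁ ℓ₂) where
  open OrderedCommRing R

  record IsExecution {ℓmax} (𝒩 : Network ℓmax) (τ : Carrier)
                     (F : (ℓ : Fin (suc ℓmax)) → Subset (size 𝒩 ℓ))
                     (I : Fin (size 𝒩 Data.Fin.zero) → Set)
                     (x : Firing 𝒩) : Set (ℓ₂) where
    field
      input-0     : ∀ u → (x Data.Fin.zero u 0 ≡ true) ⇔ I u
      input-later : ∀ u t → x Data.Fin.zero u (suc t) ≡ false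
      upper-0     : ∀ i v → x (Data.Fin.suc i) v 0 ≡ false
      upper-step  : ∀ i v t →
        (x (Data.Fin.suc i) v (suc t) ≡ true) ⇔
        (v ∉ F (Data.Fin.suc i) ×
         τ ≤ embed ∣ tabulate (λ u → w 𝒩 i u v ∧ x (inject₁ i) u t) ∣)

  module _ {ℓmax n k : ℕ} (𝒞 : ConceptHierarchy ℓmax n k) where
    open ConceptHierarchy 𝒞

    record IsA1 (𝒩 : Network ℓmax)
                (rep : (ℓ : Fin (suc ℓmax)) → Fin (dsz ℓ) → Fin (size 𝒩 ℓ)) : Set where
      field
        rep-distinct : ∀ ℓ c c' → c ∈ C ℓ → c' ∈ C ℓ → rep ℓ c ≡ rep ℓ c' → c ≡ c'
        weights : ∀ i u v → (w 𝒩 i u v ≡ true) ⇔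
          (∃[ c ] ∃[ c' ] (c ∈ C (Data.Fin.suc i) × c' ∈ children i c ×
                           v ≡ rep (Data.Fin.suc i) c × u ≡ rep (inject₁ i) c'))

    τA1 : (r₂ : Carrier) → Carrier
    τA1 r₂ = r₂ * embed k

    noFailures : (𝒩 : Network ℓmax) → (ℓ : Fin (suc ℓmax)) → Subset (size 𝒩 ℓ)
    noFailures 𝒩 ℓ = Data.Fin.Subset.⊥

    inputA1 : (𝒩 : Network ℓmax)
              (rep : (ℓ : Fin (suc ℓmax)) → Fin (dsz ℓ) → Fin (size 𝒩 ℓ)) →
              Subset (dsz Data.Fin.zero) → Fin (size 𝒩 Data.Fin.zero) → Set
    inputA1 𝒩 rep B u = ∃[ b ] (b ∈ B × u ≡ rep Data.Fin.zero b)

    record IsH (m : ℕ) (ε : Carrier) (𝒩 : Network ℓmax)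
               (reps : (ℓ : Fin (suc ℓmax)) → Fin (dsz ℓ) → Subset (size 𝒩 ℓ))
               (F : (ℓ : Fin (suc ℓmax)) → Subset (size 𝒩 ℓ)) : Set ℓ₂ where
      field
        reps-size : ∀ ℓ c → c ∈ C ℓ → ∣ reps ℓ c ∣ ≡ m
        reps-disj : ∀ ℓ c c' → c ∈ C ℓ → c' ∈ C ℓ → c ≢ c' →
                    ∀ v → v ∈ reps ℓ c → v ∉ reps ℓ c'
        weights : ∀ i u v → (w 𝒩 i u v ≡ true) ⇔
          (∃[ c ] ∃[ c' ] (c ∈ C (Data.Fin.suc i) × c' ∈ children i c ×
                           v ∈ reps (Data.Fin.suc i) c × u ∈ reps (inject₁ i) c'))
        failures : ∀ ℓ c → c ∈ C ℓ →
                   (embed m * (1# - ε)) ≤ embed ∣ reps ℓ c ∩ ∁ (F ℓ) ∣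

    τH : (m : ℕ) (r₂ ε : Carrier) → Carrier
    τH m r₂ ε = ((r₂ * embed k) * embed m) * (1# - ε)

    inputH : (𝒩 : Network ℓmax)
             (reps : (ℓ : Fin (suc ℓmax)) → Fin (dsz ℓ) → Subset (size 𝒩 ℓ))
             (F : (ℓ : Fin (suc ℓmax)) → Subset (size 𝒩 ℓ)) →
             Subset (dsz Data.Fin.zero) → Fin (size 𝒩 Data.Fin.zero) → Set
    inputH 𝒩 reps F B u = (∃[ b ] (b ∈ B × u ∈ reps Data.Fin.zero b)) × u ∉ F Data.Fin.zero

    firingAt : (𝒩 : Network ℓmax) → Firing 𝒩 → (ℓ : Fin (suc ℓmax)) → ℕ → Subset (size 𝒩 ℓ)
    firingAt 𝒩 x ℓ t = tabulate (λ v → x ℓ v t)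

{-# OPTIONS --safe #-}

-- At level 0 the surviving representatives of a
-- presented concept fire by definition of the input.  If rep c fires at
-- level ℓ + 1 in 𝒜₁, at least r₂k children of c fired at level ℓ; by
-- induction each of them has at least m(1 − ε) firing representatives in 𝓗.
-- Representative sets of distinct children are disjoint and all of them are
-- wired to every representative of c, so each surviving representative of c
-- sees at least r₂k · m(1 − ε) = τ firing inputs and fires.  Finally, at
-- least m(1 − ε) representatives of any concept survive.

module Submission where

open import Defs
open import Level using (Level)
open import Data.Nat using (ℕ; _>_)
open import Data.Fin using (Fin; toℕ)
open import Data.Fin.Subset using (Subset; _∈_; _⊆_; ∣_∣; _∩_)
open import Data.Bool using (true)
open import Data.Product using (_×_; _,_)
open import Relation.Binary.PropositionalEquality using (_≡_; refl)

module SubsetCounting where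
  open import Data.Nat using (suc; _+_; _≤_; z≤n)
  open import Data.Nat.Properties using (+-suc; +-mono-≤; ≤-trans; ≤-reflexive; module ≤-Reasoning)
  open import Data.Fin using (zero; suc)
  open import Data.Fin.Properties using (suc-injective)
  open import Data.Fin.Subset using (_∉_; ∁; ⁅_⁆; ⊥)
  open import Data.Fin.Subset.Properties
    using (p⊆q⇒∣p∣≤∣q∣; ∣⊥∣≡0; ∣⁅x⁆∣≡1; x∈⁅x⁆; ∣p∩q∣≤∣q∣; x∈p∩q⁺; x∈p∩q⁻; x∉p⇒x∈∁p; x∈∁p⇒x∉p)
  open import Data.Vec using ([]; _∷_; tabulate; here; there)
  open import Data.Vec.Properties using (lookup∘tabulate; []=⇒lookup; lookup⇒[]=)
  open import Data.Bool using (Bool; false; _∧_)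
  open import Data.Product using (∃-syntax)
  open import Data.Empty using (⊥-elim)
  open import Relation.Nullary using (¬_)
  open import Relation.Binary.PropositionalEquality using (_≢_; sym; trans; cong; subst)

  ∈-tabulate⁺ : ∀ {n} (f : Fin n → Bool) {i} → f i ≡ true → i ∈ tabulate f
  ∈-tabulate⁺ f {i} fi = lookup⇒[]= i (tabulate f) (trans (lookup∘tabulate f i) fi)

  ∈-tabulate⁻ : ∀ {n} (f : Fin n → Bool) {i} → i ∈ tabulate f → f i ≡ true
  ∈-tabulate⁻ f {i} i∈ = trans (sym (lookup∘tabulate f i)) ([]=⇒lookup i∈)

  ∧≡true⁺ : ∀ {a b} → a ≡ true → b ≡ true → a ∧ b ≡ true
  ∧≡true⁺ refl refl = refl

  ∧≡true⁻ : ∀ {a b} → a ∧ b ≡ true → a ≡ true × b ≡ true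
  ∧≡true⁻ {true} {true} _ = refl , refl

  ∣p∣≡∣p∩q∣+∣p∩∁q∣ : ∀ {n} (p q : Subset n) → ∣ p ∣ ≡ ∣ p ∩ q ∣ + ∣ p ∩ ∁ q ∣
  ∣p∣≡∣p∩q∣+∣p∩∁q∣ []          []          = refl
  ∣p∣≡∣p∩q∣+∣p∩∁q∣ (true  ∷ p) (true  ∷ q) = cong suc (∣p∣≡∣p∩q∣+∣p∩∁q∣ p q)
  ∣p∣≡∣p∩q∣+∣p∩∁q∣ (true  ∷ p) (false ∷ q) =
    trans (cong suc (∣p∣≡∣p∩q∣+∣p∩∁q∣ p q)) (sym (+-suc ∣ p ∩ q ∣ _))
  ∣p∣≡∣p∩q∣+∣p∩∁q∣ (false ∷ p) (true  ∷ q) = ∣p∣≡∣p∩q∣+∣p∩∁q∣ p q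
  ∣p∣≡∣p∩q∣+∣p∩∁q∣ (false ∷ p) (false ∷ q) = ∣p∣≡∣p∩q∣+∣p∩∁q∣ p q

  p⊆f[q]⇒∣p∣≤∣q∣ : ∀ {a b} (q : Subset a) (f : Fin a → Fin b) (p : Subset b) →
    (∀ {u} → u ∈ p → ∃[ i ] (i ∈ q × u ≡ f i)) → ∣ p ∣ ≤ ∣ q ∣
  p⊆f[q]⇒∣p∣≤∣q∣ {b = b} [] f p p⊆f[q] =
    ≤-trans (p⊆q⇒∣p∣≤∣q∣ {q = ⊥} (λ u∈p → ⊥-elim (no-index-in-[] (p⊆f[q] u∈p)))) (≤-reflexive (∣⊥∣≡0 b))
    where
    no-index-in-[] : ∀ {u} → ¬ (∃[ i ] (i ∈ [] × u ≡ f i))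
    no-index-in-[] (() , _)
  p⊆f[q]⇒∣p∣≤∣q∣ (false ∷ q) f p p⊆f[q] = p⊆f[q]⇒∣p∣≤∣q∣ q (λ i → f (suc i)) p p⊆f[q∖0]
    where
    p⊆f[q∖0] : ∀ {u} → u ∈ p → ∃[ i ] (i ∈ q × u ≡ f (suc i))
    p⊆f[q∖0] u∈p with p⊆f[q] u∈p
    ... | suc i , there i∈q , u≡fi = i , i∈q , u≡fi
  p⊆f[q]⇒∣p∣≤∣q∣ (true ∷ q) f p p⊆f[q] = begin
    ∣ p ∣                                      ≡⟨ ∣p∣≡∣p∩q∣+∣p∩∁q∣ p ⁅ f zero ⁆ ⟩
    ∣ p ∩ ⁅ f zero ⁆ ∣ + ∣ p ∩ ∁ ⁅ f zero ⁆ ∣  ≤⟨ +-mono-≤ at-most-one rest ⟩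
    suc ∣ q ∣                                  ∎
    where
    open ≤-Reasoning
    at-most-one : ∣ p ∩ ⁅ f zero ⁆ ∣ ≤ 1
    at-most-one = ≤-trans (∣p∩q∣≤∣q∣ p _) (≤-reflexive (∣⁅x⁆∣≡1 (f zero)))
    p∖f0⊆f[q] : ∀ {u} → u ∈ p ∩ ∁ ⁅ f zero ⁆ → ∃[ i ] (i ∈ q × u ≡ f (suc i))
    p∖f0⊆f[q] u∈ with x∈p∩q⁻ p _ u∈
    ... | u∈p , u∉f0 with p⊆f[q] u∈p
    ... | zero , _ , u≡f0 = ⊥-elim (x∈∁p⇒x∉p u∉f0 (subst (_∈ ⁅ f zero ⁆) (sym u≡f0) (x∈⁅x⁆ (f zero))))
    ... | suc i , there i∈q , u≡fi = i , i∈q , u≡fi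
    rest : ∣ p ∩ ∁ ⁅ f zero ⁆ ∣ ≤ ∣ q ∣
    rest = p⊆f[q]⇒∣p∣≤∣q∣ q (λ i → f (suc i)) (p ∩ ∁ ⁅ f zero ⁆) p∖f0⊆f[q]

  sumOver : ∀ {a} → Subset a → (Fin a → ℕ) → ℕ
  sumOver []          g = 0
  sumOver (true  ∷ S) g = g zero + sumOver S (λ i → g (suc i))
  sumOver (false ∷ S) g = sumOver S (λ i → g (suc i))

  Disjoint : ∀ {n} → Subset n → Subset n → Set
  Disjoint p q = ∀ {x} → x ∈ p → x ∉ q

  PairwiseDisjointOn : ∀ {a b} → Subset a → (Fin a → Subset b) → Set
  PairwiseDisjointOn S G = ∀ {i j} → i ∈ S → j ∈ S → i ≢ j → Disjoint (G i) (G j)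

  sumOver-disjoint⊆p≤∣p∣ : ∀ {a b} (S : Subset a) (G : Fin a → Subset b) (p : Subset b) →
    PairwiseDisjointOn S G → (∀ {i} → i ∈ S → G i ⊆ p) → sumOver S (λ i → ∣ G i ∣) ≤ ∣ p ∣
  sumOver-disjoint⊆p≤∣p∣ [] G p _ _ = z≤n
  sumOver-disjoint⊆p≤∣p∣ (false ∷ S) G p disj G⊆p =
    sumOver-disjoint⊆p≤∣p∣ S (λ i → G (suc i)) p
      (λ i∈S j∈S i≢j → disj (there i∈S) (there j∈S) (λ si≡sj → i≢j (suc-injective si≡sj)))
      (λ i∈S → G⊆p (there i∈S))
  sumOver-disjoint⊆p≤∣p∣ (true ∷ S) G p disj G⊆p = begin
    ∣ G zero ∣ + sumOver S (λ i → ∣ G (suc i) ∣)  ≤⟨ +-mono-≤ (p⊆q⇒∣p∣≤∣q∣ G0⊆p∩G0) rest ⟩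
    ∣ p ∩ G zero ∣ + ∣ p ∩ ∁ (G zero) ∣            ≡⟨ ∣p∣≡∣p∩q∣+∣p∩∁q∣ p (G zero) ⟨
    ∣ p ∣                                          ∎
    where
    open ≤-Reasoning
    G0⊆p∩G0 : G zero ⊆ p ∩ G zero
    G0⊆p∩G0 v∈G0 = x∈p∩q⁺ (G⊆p here v∈G0 , v∈G0)
    rest : sumOver S (λ i → ∣ G (suc i) ∣) ≤ ∣ p ∩ ∁ (G zero) ∣
    rest = sumOver-disjoint⊆p≤∣p∣ S (λ i → G (suc i)) (p ∩ ∁ (G zero))
      (λ i∈S j∈S i≢j → disj (there i∈S) (there j∈S) (λ si≡sj → i≢j (suc-injective si≡sj)))
      (λ i∈S v∈Gi → x∈p∩q⁺ (G⊆p (there i∈S) v∈Gi ,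
                            x∉p⇒x∈∁p (disj (there i∈S) here (λ ()) v∈Gi)))

open SubsetCounting

module OrderedCommRingProperties {c ℓ₁ ℓ₂} (R : OrderedCommRing c ℓ₁ ℓ₂) where
  import Data.Nat as ℕ
  open import Data.Nat using (zero; suc; z≤n; s≤s)
  open import Data.Fin using (zero; suc)
  open import Data.Vec using ([]; _∷_; here; there)
  open import Data.Bool using (false)
  open import Data.Sum using (inj₁; inj₂)
  open import Relation.Binary.Bundles using (Poset)
  open import Relation.Binary.Structures using (IsTotalOrder)
  open OrderedCommRing R hiding (zero)
  open import Algebra.Properties.Ring ring using (-‿distribˡ-*; -‿distribʳ-*; -‿involutive)

  poset : Poset c ℓ₁ ℓ₂
  poset = record { isPartialOrder = IsTotalOrder.isPartialOrder isTotalOrder }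

  open IsTotalOrder isTotalOrder using (total; ≤-respˡ-≈; ≤-respʳ-≈) renaming (refl to ≤-refl)
  open IsTotalOrder isTotalOrder public using () renaming (trans to ≤-trans)
  open import Relation.Binary.Reasoning.PartialOrder poset

  +-monoʳ-≤ : ∀ {x y} z → x ≤ y → (z + x) ≤ (z + y)
  +-monoʳ-≤ {x} {y} z x≤y = begin
    z + x  ≈⟨ +-comm z x ⟩
    x + z  ≤⟨ +-monoˡ-≤ z x≤y ⟩
    y + z  ≈⟨ +-comm y z ⟩
    z + y  ∎

  +-mono-≤ : ∀ {x y u v} → x ≤ y → u ≤ v → (x + u) ≤ (y + v)
  +-mono-≤ {x} {y} {u} {v} x≤y u≤v = begin
    x + u  ≤⟨ +-monoˡ-≤ u x≤y ⟩
    y + u  ≤⟨ +-monoʳ-≤ y u≤v ⟩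
    y + v  ∎

  x≤y⇒0≤y-x : ∀ {x y} → x ≤ y → 0# ≤ (y - x)
  x≤y⇒0≤y-x {x} {y} x≤y = begin
    0#     ≈⟨ -‿inverseʳ x ⟨
    x - x  ≤⟨ +-monoˡ-≤ (- x) x≤y ⟩
    y - x  ∎

  0≤x*x : ∀ x → 0# ≤ (x * x)
  0≤x*x x with total 0# x
  ... | inj₁ 0≤x = *-nonneg 0≤x 0≤x
  ... | inj₂ x≤0 = begin
    0#           ≤⟨ *-nonneg 0≤-x 0≤-x ⟩
    - x * - x    ≈⟨ -‿distribˡ-* x (- x) ⟨
    - (x * - x)  ≈⟨ -‿cong (-‿distribʳ-* x x) ⟨
    - - (x * x)  ≈⟨ -‿involutive (x * x) ⟩
    x * x        ∎
    where
    0≤-x : 0# ≤ (- x)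
    0≤-x = ≤-respʳ-≈ (+-identityˡ (- x)) (x≤y⇒0≤y-x x≤0)

  0≤1 : 0# ≤ 1#
  0≤1 = ≤-respʳ-≈ (*-identityˡ 1#) (0≤x*x 1#)

  *-monoˡ-≤-nonNeg : ∀ {x y z} → 0# ≤ z → x ≤ y → (x * z) ≤ (y * z)
  *-monoˡ-≤-nonNeg {x} {y} {z} 0≤z x≤y = begin
    x * z                  ≈⟨ +-identityˡ (x * z) ⟨
    0# + x * z             ≤⟨ +-monoˡ-≤ (x * z) (*-nonneg (x≤y⇒0≤y-x x≤y) 0≤z) ⟩
    (y - x) * z + x * z    ≈⟨ distribʳ z (y - x) x ⟨
    ((y - x) + x) * z      ≈⟨ *-congʳ y-x+x≈y ⟩
    y * z                  ∎
    where
    y-x+x≈y : (y - x) + x ≈ y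
    y-x+x≈y = trans (+-assoc y (- x) x) (trans (+-congˡ (-‿inverseˡ x)) (+-identityʳ y))

  embed-+ : ∀ a b → embed (a ℕ.+ b) ≈ embed a + embed b
  embed-+ zero    b = sym (+-identityˡ (embed b))
  embed-+ (suc a) b = trans (+-congˡ (embed-+ a b)) (sym (+-assoc 1# (embed a) (embed b)))

  embed-nonNeg : ∀ a → 0# ≤ embed a
  embed-nonNeg zero    = ≤-refl
  embed-nonNeg (suc a) = begin
    0#            ≈⟨ +-identityˡ 0# ⟨
    0# + 0#       ≤⟨ +-mono-≤ 0≤1 (embed-nonNeg a) ⟩
    1# + embed a  ∎

  embed-mono-≤ : ∀ {a b} → a ℕ.≤ b → embed a ≤ embed b
  embed-mono-≤ {b = b} z≤n = embed-nonNeg b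
  embed-mono-≤ (s≤s a≤b)   = +-monoʳ-≤ 1# (embed-mono-≤ a≤b)

  embed∣S∣*q≤sumOver : ∀ {a} (S : Subset a) (g : Fin a → ℕ) {q} →
    (∀ {i} → i ∈ S → q ≤ embed (g i)) → (embed ∣ S ∣ * q) ≤ embed (sumOver S g)
  embed∣S∣*q≤sumOver []          g {q} _     = ≤-respˡ-≈ (sym (zeroˡ q)) ≤-refl
  embed∣S∣*q≤sumOver (false ∷ S) g q≤g = embed∣S∣*q≤sumOver S (λ i → g (suc i)) (λ i∈S → q≤g (there i∈S))
  embed∣S∣*q≤sumOver (true  ∷ S) g {q} q≤g = begin
    (1# + embed ∣ S ∣) * q                     ≈⟨ distribʳ q 1# (embed ∣ S ∣) ⟩
    1# * q + embed ∣ S ∣ * q                   ≈⟨ +-congʳ (*-identityˡ q) ⟩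
    q + embed ∣ S ∣ * q                        ≤⟨ +-mono-≤ (q≤g here) rest ⟩
    embed (g zero) + embed (sumOver S g₊)      ≈⟨ embed-+ (g zero) (sumOver S g₊) ⟨
    embed (g zero ℕ.+ sumOver S g₊)            ∎
    where
    g₊ : Fin _ → ℕ
    g₊ i = g (suc i)
    rest : (embed ∣ S ∣ * q) ≤ embed (sumOver S g₊)
    rest = embed∣S∣*q≤sumOver S g₊ (λ i∈S → q≤g (there i∈S))


module _ {c ℓ₁ ℓ₂} (R : OrderedCommRing c ℓ₁ ℓ₂) {ℓmax n k : ℕ} (𝒞 : ConceptHierarchy ℓmax n k) where
  import Data.Nat as ℕ
  open import Data.Nat using (zero; suc)
  open import Data.Nat.Properties using (suc-injective)
  open import Data.Fin using (zero; suc; inject₁)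
  open import Data.Fin.Properties using (toℕ-inject₁)
  open import Data.Fin.Subset using (_∉_; ∁)
  open import Data.Fin.Subset.Properties using (p⊆q⇒∣p∣≤∣q∣; p∩q⊆p; x∈p∩q⁺; x∈p∩q⁻; x∈∁p⇒x∉p)
  open import Data.Vec using (tabulate)
  open import Data.Bool using (_∧_)
  open import Data.Product using (proj₁; proj₂; ∃-syntax)
  open import Function.Bundles using (Equivalence)
  open import Relation.Binary.PropositionalEquality using (trans; subst)
  open OrderedCommRing R hiding (zero; refl; trans)
  open OrderedCommRingProperties R
  open import Relation.Binary.Reasoning.PartialOrder poset
  open ConceptHierarchy 𝒞

  module A₁Execution
      (r₂ : Carrier) (𝒩 : Network ℓmax)
      (rep : (ℓ : Fin (suc ℓmax)) → Fin (dsz ℓ) → Fin (size 𝒩 ℓ)) (isA₁ : IsA1 R 𝒞 𝒩 rep)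
      (B : Subset (dsz zero)) (x : Firing 𝒩)
      (exec : IsExecution R 𝒩 (τA1 R 𝒞 r₂) (noFailures R 𝒞 𝒩) (inputA1 R 𝒞 𝒩 rep B) x) where
    open IsA1 isA₁
    open IsExecution exec

    fires-at-0⇒presented : B ⊆ C zero → ∀ {c} → c ∈ C zero → x zero (rep zero c) 0 ≡ true → c ∈ B
    fires-at-0⇒presented B⊆C {c} c∈C fires with Equivalence.to (input-0 (rep zero c)) fires
    ... | b , b∈B , rep-c≡rep-b with rep-distinct zero c b c∈C (B⊆C b∈B) rep-c≡rep-b
    ... | refl = b∈B

    firingChildren : (i : Fin ℓmax) → Fin (dsz (suc i)) → ℕ → Subset (dsz (inject₁ i))
    firingChildren i c t = children i c ∩ tabulate (λ c′ → x (inject₁ i) (rep (inject₁ i) c′) t)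

    fires⇒r₂k≤∣firingChildren∣ : ∀ {i c t} → c ∈ C (suc i) → x (suc i) (rep (suc i) c) (suc t) ≡ true →
      (r₂ * embed k) ≤ embed ∣ firingChildren i c t ∣
    fires⇒r₂k≤∣firingChildren∣ {i} {c} {t} c∈C fires = begin
      r₂ * embed k                    ≤⟨ proj₂ (Equivalence.to (upper-step i (rep (suc i) c) t) fires) ⟩
      embed ∣ inputs ∣                ≤⟨ embed-mono-≤ ∣inputs∣≤∣firingChildren∣ ⟩
      embed ∣ firingChildren i c t ∣  ∎
      where
      inputs : Subset (size 𝒩 (inject₁ i))
      inputs = tabulate (λ u → w 𝒩 i u (rep (suc i) c) ∧ x (inject₁ i) u t)
      inputs⊆rep[firingChildren] : ∀ {u} → u ∈ inputs →
        ∃[ c′ ] (c′ ∈ firingChildren i c t × u ≡ rep (inject₁ i) c′)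
      inputs⊆rep[firingChildren] {u} u∈ with ∧≡true⁻ (∈-tabulate⁻ _ u∈)
      ... | edge , u-fires with Equivalence.to (weights i u (rep (suc i) c)) edge
      ... | c″ , c′ , c″∈C , c′∈children , rep-c≡rep-c″ , u≡rep-c′
            with rep-distinct (suc i) c c″ c∈C c″∈C rep-c≡rep-c″
      ... | refl = c′ , x∈p∩q⁺ (c′∈children , ∈-tabulate⁺ _ rep-c′-fires) , u≡rep-c′
        where rep-c′-fires = subst (λ v → x (inject₁ i) v t ≡ true) u≡rep-c′ u-fires
      ∣inputs∣≤∣firingChildren∣ : ∣ inputs ∣ ℕ.≤ ∣ firingChildren i c t ∣
      ∣inputs∣≤∣firingChildren∣ = p⊆f[q]⇒∣p∣≤∣q∣ _ (rep (inject₁ i)) inputs inputs⊆rep[firingChildren]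

  module HExecution
      (m : ℕ) (r₂ ε : Carrier) (𝒩 : Network ℓmax)
      (reps : (ℓ : Fin (suc ℓmax)) → Fin (dsz ℓ) → Subset (size 𝒩 ℓ))
      (F : (ℓ : Fin (suc ℓmax)) → Subset (size 𝒩 ℓ)) (isH : IsH R 𝒞 m ε 𝒩 reps F)
      (B : Subset (dsz zero)) (x : Firing 𝒩)
      (exec : IsExecution R 𝒩 (τH R 𝒞 m r₂ ε) F (inputH R 𝒞 𝒩 reps F B) x) where
    open IsH isH
    open IsExecution exec

    firingReps : (ℓ : Fin (suc ℓmax)) → Fin (dsz ℓ) → ℕ → Subset (size 𝒩 ℓ)
    firingReps ℓ c t = reps ℓ c ∩ firingAt R 𝒞 𝒩 x ℓ t

    LiveRepsFire : (ℓ : Fin (suc ℓmax)) → Fin (dsz ℓ) → ℕ → Set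
    LiveRepsFire ℓ c t = ∀ {v} → v ∈ reps ℓ c → v ∉ F ℓ → x ℓ v t ≡ true

    liveRepsFire⇒m[1-ε]≤∣firingReps∣ : ∀ {ℓ c t} → c ∈ C ℓ → LiveRepsFire ℓ c t →
      (embed m * (1# - ε)) ≤ embed ∣ firingReps ℓ c t ∣
    liveRepsFire⇒m[1-ε]≤∣firingReps∣ {ℓ} {c} {t} c∈C live-fire = begin
      embed m * (1# - ε)           ≤⟨ failures ℓ c c∈C ⟩
      embed ∣ reps ℓ c ∩ ∁ (F ℓ) ∣  ≤⟨ embed-mono-≤ (p⊆q⇒∣p∣≤∣q∣ live⊆firing) ⟩
      embed ∣ firingReps ℓ c t ∣   ∎
      where
      live⊆firing : reps ℓ c ∩ ∁ (F ℓ) ⊆ firingReps ℓ c t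
      live⊆firing v∈ with x∈p∩q⁻ (reps ℓ c) _ v∈
      ... | v∈reps , v∉F = x∈p∩q⁺ (v∈reps , ∈-tabulate⁺ _ (live-fire v∈reps (x∈∁p⇒x∉p v∉F)))

    presented⇒liveRepsFire : ∀ {c} → c ∈ B → LiveRepsFire zero c 0
    presented⇒liveRepsFire c∈B v∈reps v∉F = Equivalence.from (input-0 _) ((_ , c∈B , v∈reps) , v∉F)

    inputs : (i : Fin ℓmax) → Fin (size 𝒩 (suc i)) → ℕ → Subset (size 𝒩 (inject₁ i))
    inputs i v t = tabulate (λ u → w 𝒩 i u v ∧ x (inject₁ i) u t)

    module _ {i c t} (c∈C : c ∈ C (suc i)) {S} (S⊆children : S ⊆ children i c) {q}
             (q≤∣firingReps∣ : ∀ {c′} → c′ ∈ S → q ≤ embed ∣ firingReps (inject₁ i) c′ t ∣) where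

      ∣S∣*q≤∣inputs∣ : ∀ {v} → v ∈ reps (suc i) c → (embed ∣ S ∣ * q) ≤ embed ∣ inputs i v t ∣
      ∣S∣*q≤∣inputs∣ {v} v∈reps = begin
        embed ∣ S ∣ * q                ≤⟨ embed∣S∣*q≤sumOver S _ q≤∣firingReps∣ ⟩
        embed (sumOver S ∣firingReps∣) ≤⟨ embed-mono-≤ (sumOver-disjoint⊆p≤∣p∣ S _ _ disjoint ⊆inputs) ⟩
        embed ∣ inputs i v t ∣         ∎
        where
        ∣firingReps∣ : Fin (dsz (inject₁ i)) → ℕ
        ∣firingReps∣ c′ = ∣ firingReps (inject₁ i) c′ t ∣
        children-in-C : ∀ {c′} → c′ ∈ S → c′ ∈ C (inject₁ i)
        children-in-C c′∈S = children-⊆ i c c∈C (S⊆children c′∈S)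
        disjoint : PairwiseDisjointOn S (λ c′ → firingReps (inject₁ i) c′ t)
        disjoint {a} {b} a∈S b∈S a≢b {u} u∈a u∈b =
          reps-disj (inject₁ i) a b (children-in-C a∈S) (children-in-C b∈S) a≢b u
            (proj₁ (x∈p∩q⁻ (reps _ a) _ u∈a)) (proj₁ (x∈p∩q⁻ (reps _ b) _ u∈b))
        ⊆inputs : ∀ {c′} → c′ ∈ S → firingReps (inject₁ i) c′ t ⊆ inputs i v t
        ⊆inputs {c′} c′∈S {u} u∈ with x∈p∩q⁻ (reps _ c′) _ u∈
        ... | u∈reps , u-fires = ∈-tabulate⁺ _ (∧≡true⁺ edge (∈-tabulate⁻ _ u-fires))
          where
          edge = Equivalence.from (weights i u v) (c , c′ , c∈C , S⊆children c′∈S , v∈reps , u∈reps)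

      firingChildren⇒liveRepsFire : τH R 𝒞 m r₂ ε ≤ (embed ∣ S ∣ * q) → LiveRepsFire (suc i) c (suc t)
      firingChildren⇒liveRepsFire τ≤∣S∣*q {v} v∈reps v∉F =
        Equivalence.from (upper-step i v t) (v∉F , ≤-trans τ≤∣S∣*q (∣S∣*q≤∣inputs∣ v∈reps))

  module Simulation
      (m : ℕ) (r₂ ε : Carrier) (ε≤1 : ε ≤ 1#)
      (𝒩₁ : Network ℓmax) (rep : (ℓ : Fin (suc ℓmax)) → Fin (dsz ℓ) → Fin (size 𝒩₁ ℓ))
      (isA₁ : IsA1 R 𝒞 𝒩₁ rep)
      (𝒩₂ : Network ℓmax) (reps : (ℓ : Fin (suc ℓmax)) → Fin (dsz ℓ) → Subset (size 𝒩₂ ℓ))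
      (F : (ℓ : Fin (suc ℓmax)) → Subset (size 𝒩₂ ℓ)) (isH : IsH R 𝒞 m ε 𝒩₂ reps F)
      (B : Subset (dsz zero)) (B⊆C : B ⊆ C zero)
      (x₁ : Firing 𝒩₁)
      (exec₁ : IsExecution R 𝒩₁ (τA1 R 𝒞 r₂) (noFailures R 𝒞 𝒩₁) (inputA1 R 𝒞 𝒩₁ rep B) x₁)
      (x₂ : Firing 𝒩₂)
      (exec₂ : IsExecution R 𝒩₂ (τH R 𝒞 m r₂ ε) F (inputH R 𝒞 𝒩₂ reps F B) x₂) where
    open A₁Execution r₂ 𝒩₁ rep isA₁ B x₁ exec₁
    open HExecution m r₂ ε 𝒩₂ reps F isH B x₂ exec₂ public

    0≤m[1-ε] : 0# ≤ (embed m * (1# - ε))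
    0≤m[1-ε] = *-nonneg (embed-nonNeg m) (x≤y⇒0≤y-x ε≤1)

    -- Recursion is on the time t = toℕ ℓ, since the level below suc i is inject₁ i rather than i.
    simulation : ∀ t {ℓ c} → toℕ ℓ ≡ t → c ∈ C ℓ → x₁ ℓ (rep ℓ c) t ≡ true → LiveRepsFire ℓ c t
    simulation zero    {zero}  _ c∈C fires = presented⇒liveRepsFire (fires-at-0⇒presented B⊆C c∈C fires)
    simulation zero    {suc _} ()
    simulation (suc t) {zero}  ()
    simulation (suc t) {suc i} {c} ℓ≡t c∈C fires =
      firingChildren⇒liveRepsFire c∈C (p∩q⊆p _ _) children-fire threshold
      where
      children-fire : ∀ {c′} → c′ ∈ firingChildren i c t →
        (embed m * (1# - ε)) ≤ embed ∣ firingReps (inject₁ i) c′ t ∣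
      children-fire c′∈ with x∈p∩q⁻ (children i c) _ c′∈
      ... | c′∈children , c′-fires = liveRepsFire⇒m[1-ε]≤∣firingReps∣ c′∈C
              (simulation t (trans (toℕ-inject₁ i) (suc-injective ℓ≡t)) c′∈C (∈-tabulate⁻ _ c′-fires))
        where c′∈C = children-⊆ i c c∈C c′∈children
      threshold : τH R 𝒞 m r₂ ε ≤ (embed ∣ firingChildren i c t ∣ * (embed m * (1# - ε)))
      threshold = begin
        ((r₂ * embed k) * embed m) * (1# - ε)
          ≈⟨ *-assoc _ _ _ ⟩
        (r₂ * embed k) * (embed m * (1# - ε))
          ≤⟨ *-monoˡ-≤-nonNeg 0≤m[1-ε] (fires⇒r₂k≤∣firingChildren∣ c∈C fires) ⟩
        embed ∣ firingChildren i c t ∣ * (embed m * (1# - ε))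
          ∎

theorem9 : ∀ {c ℓ₁ ℓ₂ : Level} (R : OrderedCommRing c ℓ₁ ℓ₂) →
  let open OrderedCommRing R in
  (ℓmax n k m : ℕ) → ℓmax > 0 → n > 0 → k > 0 → m > 0 →
  (r₁ r₂ ε : Carrier) →
  (0# ≤ r₁) × (r₁ ≤ 1#) → (0# ≤ r₂) × (r₂ ≤ 1#) → (0# ≤ ε) × (ε ≤ 1#) →
  r₁ ≤ (r₂ * (1# - ε)) →
  (𝒞 : ConceptHierarchy ℓmax n k) →
  let open ConceptHierarchy 𝒞 in
  (𝒩₁ : Network ℓmax) (rep : (ℓ : Fin _) → Fin (dsz ℓ) → Fin (size 𝒩₁ ℓ)) →
  IsA1 R 𝒞 𝒩₁ rep →
  (𝒩₂ : Network ℓmax) (reps : (ℓ : Fin _) → Fin (dsz ℓ) → Subset (size 𝒩₂ ℓ))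
  (F : (ℓ : Fin _) → Subset (size 𝒩₂ ℓ)) →
  IsH R 𝒞 m ε 𝒩₂ reps F →
  (B : Subset (dsz Data.Fin.zero)) → B ⊆ C Data.Fin.zero →
  (x₁ : Firing 𝒩₁) →
  IsExecution R 𝒩₁ (τA1 R 𝒞 r₂) (noFailures R 𝒞 𝒩₁) (inputA1 R 𝒞 𝒩₁ rep B) x₁ →
  (x₂ : Firing 𝒩₂) →
  IsExecution R 𝒩₂ (τH R 𝒞 m r₂ ε) F (inputH R 𝒞 𝒩₂ reps F B) x₂ →
  (ℓ : Fin _) (c : Fin (dsz ℓ)) → c ∈ C ℓ →
  x₁ ℓ (rep ℓ c) (toℕ ℓ) ≡ true →
  (embed m * (1# - ε)) ≤ embed ∣ reps ℓ c ∩ firingAt R 𝒞 𝒩₂ x₂ ℓ (toℕ ℓ) ∣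
theorem9 R _ _ _ m _ _ _ _ _ r₂ ε _ _ (_ , ε≤1) _ 𝒞 𝒩₁ rep isA₁ 𝒩₂ reps F isH B B⊆C
         x₁ exec₁ x₂ exec₂ ℓ c c∈C fires =
  liveRepsFire⇒m[1-ε]≤∣firingReps∣ c∈C (simulation (toℕ ℓ) refl c∈C fires)
  where open Simulation R 𝒞 m r₂ ε ε≤1 𝒩₁ rep isA₁ 𝒩₂ reps F isH B B⊆C x₁ exec₁ x₂ exec₂
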